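{- Let $R$ be a finite set and let $\mathcal{S}_1,\ldots,\mathcal{S}_k$ be $k$ collections of subsets of $R$. Construct the vertex-colored graph $(G,\mathrm{col})$ as follows. For each $i\in[k]$ and each set $S\in\mathcal{S}_i$ create a vertex (these vertices form the set $I_i$) with color $i$; the vertices of $I_1\cup\cdots\cup I_k$ form an independent set. For each $i\in[k]$ create a set $L_i$ of $3k$ new vertices, each of color $k+1$, and join every vertex of $L_i$ to every vertex of $I_i$. For each vertex $v\in L_1\cup\cdots\cup L_k$ create $k$ new degree-one vertices adjacent to $v$, colored $1,\ldots,k$ respectively. For each element $e\in R$ create a vertex $e$ of color $k+1$, and for each $i\in[k]$ and each $S\in\mathcal{S}_i$ with $e\in S$, join $e$ to the vertex of $I_i$ representing $S$. Finally add a vertex $u$ of color $k+1$ adjacent to all vertices of $I_1\cup\cdots\cup I_k$. If there exist sets $S_1\in\mathcal{S}_1,\ldots,S_k\in\mathcal{S}_k$ with $\bigcup_{i\in[k]}S_i=R$, then $\mathrm{OPT}_{\mathrm{Free}}(G,\mathrm{col})\le 2k$.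
   Context: For a graph $G=(V,E)$ and a coloring $\mathrm{col}\colon V\to[c_{\max}]$, $\mathrm{Comp}(\mathrm{col},u)$ denotes the monochromatic connected component containing $u$ (the maximal set of vertices of color $\mathrm{col}(u)$ reachable from $u$ via paths all of whose vertices have color $\mathrm{col}(u)$). A move is a pair $(u,c)$ with $u\in V$ and $c$ a color; its result is the coloring obtained by recoloring every vertex of $\mathrm{Comp}(\mathrm{col},u)$ with $c$ and leaving other vertices unchanged. A sequence of moves is applied successively. $\mathrm{OPT}_{\mathrm{Free}}(G,\mathrm{col})$ is the minimum number of moves in a sequence whose result is a constant coloring (all vertices the same color). -}

module Defs where

open import Data.Nat using (ℕ; zero; suc; _*_; _≤_)
open import Data.Fin using (Fin; inject₁; fromℕ)
open import Data.Fin.Subset using (Subset; _∈_)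
open import Data.Sum using (_⊎_)
open import Data.Product using (Σ; _×_; ∃-syntax)
open import Relation.Nullary using (¬_)
open import Relation.Binary.PropositionalEquality using (_≡_)

Coloring : Set → ℕ → Set
Coloring V c = V → Fin c

data Comp {V : Set} {c : ℕ} (Adj : V → V → Set) (col : Coloring V c) (u : V) : V → Set where
  here : Comp Adj col u u
  step : ∀ {w w'} → Comp Adj col u w → Adj w w' → col w' ≡ col u → Comp Adj col u w'

IsMoveResult : {V : Set} {c : ℕ} (Adj : V → V → Set) →
               Coloring V c → V → Fin c → Coloring V c → Set
IsMoveResult Adj col u c' col' =
  ∀ w → (Comp Adj col u w → col' w ≡ c') × (¬ Comp Adj col u w → col' w ≡ col w)

Constant : {V : Set} {c : ℕ} → Coloring V c → Set
Constant {V} col = ∀ (v w : V) → col v ≡ col w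

data Floods {V : Set} {c : ℕ} (Adj : V → V → Set) : Coloring V c → ℕ → Set where
  done : ∀ {col} → Constant col → Floods Adj col zero
  move : ∀ {col col' n} (u : V) (c' : Fin c) →
         IsMoveResult Adj col u c' col' → Floods Adj col' n → Floods Adj col (suc n)

OPTFree≤ : {V : Set} {c : ℕ} (Adj : V → V → Set) → Coloring V c → ℕ → Set
OPTFree≤ Adj col t = ∃[ n ] (n ≤ t × Floods Adj col n)

-- The construction. R = Fin r; for i : Fin k the collection 𝒮_i is
-- given as an indexed family 𝒮 i : Fin (m i) → Subset r.

data Vtx (k r : ℕ) (m : Fin k → ℕ) : Set where
  I   : (i : Fin k) → Fin (m i) → Vtx k r m
  L   : (i : Fin k) → Fin (3 * k) → Vtx k r m
  Pd  : (i : Fin k) → Fin (3 * k) → Fin k → Vtx k r m -- pendant of L i j with colour index c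
  El  : Fin r → Vtx k r m
  U   : Vtx k r m

data Edge (k r : ℕ) (m : Fin k → ℕ) (𝒮 : (i : Fin k) → Fin (m i) → Subset r) :
          Vtx k r m → Vtx k r m → Set where
  LI : ∀ i j s → Edge k r m 𝒮 (L i j) (I i s)
  LP : ∀ i j c → Edge k r m 𝒮 (L i j) (Pd i j c)
  EI : ∀ e i s → e ∈ 𝒮 i s → Edge k r m 𝒮 (El e) (I i s)
  UI : ∀ i s → Edge k r m 𝒮 U (I i s)

Adj : (k r : ℕ) (m : Fin k → ℕ) (𝒮 : (i : Fin k) → Fin (m i) → Subset r) →
      Vtx k r m → Vtx k r m → Set
Adj k r m 𝒮 a b = Edge k r m 𝒮 a b ⊎ Edge k r m 𝒮 b a

-- colours 1..k+1 are represented by Fin (suc k) as 0..k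
colG : (k r : ℕ) (m : Fin k → ℕ) → Coloring (Vtx k r m) (suc k)
colG k r m (I i s)    = inject₁ i
colG k r m (L i j)    = fromℕ k
colG k r m (Pd i j c) = inject₁ c
colG k r m (El e)     = fromℕ k
colG k r m U          = fromℕ k

module Submission where

-- Fix chosen sets σ i ∈ 𝒮_i covering R (colour i is index i-1
-- in the code, colour k+1 is fromℕ k).  Two phases of k moves
-- each flood the whole graph.
--   Phase 1: for i = 1..k, recolour the chosen vertex I i (σ i) to colour k+1.
--     Each such vertex is alone in its monochromatic component (all its
--     neighbours have colour k+1), so every move recolours exactly one vertex.
--   Phase 2: for c = 1..k, recolour the component of u to colour c.  After
--     phase 1 this component contains u, all chosen vertices, every L_i (adjacent
--     to the chosen vertex of I_i) and every element vertex (covering!); the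
--     move with colour c additionally swallows all of I_c and the pendants of
--     colour c.  After the last move every vertex has colour k.
-- Every colouring in the process is "a base colouring with a region repainted
-- in one colour".

open import Defs
open import Data.Nat using (ℕ; _*_)
open import Data.Fin using (Fin)
open import Data.Fin.Subset using (Subset; _∈_)
open import Data.Product using (Σ; ∃-syntax)

open import Data.Nat using (zero; suc; _+_; _<_; _≤_; _<?_; z≤n; s≤s)
open import Data.Nat.Properties using (≤-refl; <-irrefl; m<n⇒m<1+n; m<1+n⇒m<n∨m≡n; ≮⇒≥)
open import Data.Fin using (toℕ; fromℕ; fromℕ<; inject₁; _≟_)
open import Data.Fin.Properties using (toℕ-fromℕ<; toℕ-injective; toℕ<n; fromℕ≢inject₁; inject₁-injective)
open import Data.Product using (_×_; _,_; proj₁; proj₂)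
open import Data.Sum using (_⊎_; inj₁; inj₂)
open import Data.Empty using (⊥; ⊥-elim)
open import Data.Unit using (⊤; tt)
open import Relation.Nullary using (¬_; Dec; yes; no)
open import Relation.Nullary.Decidable using (_×-dec_; _⊎-dec_)
open import Relation.Unary using (Decidable; _⊆_)
open import Relation.Binary.PropositionalEquality using (_≡_; _≢_; refl; sym; trans; cong; subst)

module FloodIt {V : Set} {c : ℕ} (A : V → V → Set) where

  paint : {P : V → Set} → Decidable P → Fin c → Coloring V c → Coloring V c
  paint P? c′ β w with P? w
  ... | yes _ = c′
  ... | no _  = β w

  paint-in : ∀ {P : V → Set} (P? : Decidable P) {c′ β w} → P w → paint P? c′ β w ≡ c′
  paint-in P? {w = w} p with P? w
  ... | yes _ = refl
  ... | no ¬p = ⊥-elim (¬p p)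

  paint-out : ∀ {P : V → Set} (P? : Decidable P) {c′ β w} → ¬ P w → paint P? c′ β w ≡ β w
  paint-out P? {w = w} ¬p with P? w
  ... | yes p = ⊥-elim (¬p p)
  ... | no _  = refl

  paint-extend : ∀ {P Q : V → Set} (P? : Decidable P) (Q? : Decidable Q) {c′ β} →
                 P ⊆ Q → (∀ {w} → Q w → ¬ P w → β w ≡ c′) →
                 ∀ w → paint P? c′ β w ≡ paint Q? c′ β w
  paint-extend P? Q? P⊆Q added w with P? w | Q? w
  ... | yes _ | yes _ = refl
  ... | yes p | no ¬q = ⊥-elim (¬q (P⊆Q p))
  ... | no ¬p | yes q = added q ¬p
  ... | no _  | no _  = refl

  paint-constant : ∀ {P : V → Set} (P? : Decidable P) {c′ β} →
                   (∀ w → P w) → Constant (paint P? c′ β)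
  paint-constant P? all v w = trans (paint-in P? (all v)) (sym (paint-in P? (all w)))

  comp-colour : ∀ {col : Coloring V c} {u w} → Comp A col u w → col w ≡ col u
  comp-colour here           = refl
  comp-colour (step _ _ eq)  = eq

  comp-isolated : ∀ {col : Coloring V c} {u} → (∀ {w} → A u w → col w ≢ col u) →
                  ∀ {w} → Comp A col u w → w ≡ u
  comp-isolated other here = refl
  comp-isolated other (step comp adj eq) with comp-isolated other comp
  ... | refl = ⊥-elim (other adj eq)

  growth-move : ∀ {P Q : V → Set} (P? : Decidable P) (Q? : Decidable Q) {a b β u} →
                P ⊆ Q → Comp A (paint P? a β) u ⊆ Q →
                (∀ {w} → Q w → ¬ Comp A (paint P? a β) u w → paint P? a β w ≡ b) →
                IsMoveResult A (paint P? a β) u b (paint Q? b β)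
  growth-move {Q = Q} P? Q? {a} {b} {β} {u} P⊆Q comp⊆Q outside w =
      (λ comp → paint-in Q? (comp⊆Q comp))
    , λ ¬comp → unchanged ¬comp (Q? w)
    where
    unchanged : ¬ Comp A (paint P? a β) u w → Dec (Q w) → paint Q? b β w ≡ paint P? a β w
    unchanged ¬comp (yes q) = trans (paint-in Q? q) (sym (outside q ¬comp))
    unchanged ¬comp (no ¬q) = trans (paint-out Q? ¬q) (sym (paint-out P? (λ p → ¬q (P⊆Q p))))

  comp-resp : ∀ {col col′ : Coloring V c} {u w} → (∀ v → col v ≡ col′ v) →
              Comp A col u w → Comp A col′ u w
  comp-resp e here = here
  comp-resp {u = u} e (step {w' = w′} comp adj eq) =
    step (comp-resp e comp) adj (trans (sym (e w′)) (trans eq (e u)))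

  floods-resp : ∀ {col col′ : Coloring V c} {n} → (∀ v → col v ≡ col′ v) →
                Floods A col n → Floods A col′ n
  floods-resp e (done const) = done λ v w → trans (sym (e v)) (trans (const v w) (e w))
  floods-resp e (move u c′ result fl) =
    move u c′ (λ w → (λ comp → proj₁ (result w) (comp-resp (λ v → sym (e v)) comp))
                   , (λ ¬comp → trans (proj₂ (result w) (λ comp → ¬comp (comp-resp e comp))) (e w)))
         fl

  OneMove : Coloring V c → Coloring V c → Set
  OneMove col col′ = Σ V λ u → Σ (Fin c) λ c′ → IsMoveResult A col u c′ col′

  moves-then-flood : ∀ n {d} (col : ℕ → Coloring V c) →
                     (∀ t → t < n → OneMove (col t) (col (suc t))) →
                     Floods A (col n) d → Floods A (col 0) (n + d)
  moves-then-flood zero    col moves fl = fl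
  moves-then-flood (suc n) col moves fl with moves 0 (s≤s z≤n)
  ... | u , c′ , result =
    move u c′ result (moves-then-flood n (λ t → col (suc t)) (λ t t<n → moves (suc t) (s≤s t<n)) fl)

module Construction (k r : ℕ) (m : Fin k → ℕ) (𝒮 : (i : Fin k) → Fin (m i) → Subset r)
                    (σ : (i : Fin k) → Fin (m i))
                    (cover : ∀ (e : Fin r) → ∃[ i ] (e ∈ 𝒮 i (σ i))) where

  open FloodIt {c = suc k} (Adj k r m 𝒮)

  G : Vtx k r m → Vtx k r m → Set
  G = Adj k r m 𝒮

  col₀ : Coloring (Vtx k r m) (suc k)
  col₀ = colG k r m

  top : Fin (suc k)
  top = fromℕ k

  top≢ : ∀ (i : Fin k) → top ≢ inject₁ i
  top≢ i = fromℕ≢inject₁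

  Selected : ℕ → Vtx k r m → Set
  Selected t (I i x) = toℕ i < t × x ≡ σ i
  Selected t _       = ⊥

  selected? : ∀ t → Decidable (Selected t)
  selected? t (I i x)    = (toℕ i <? t) ×-dec (x ≟ σ i)
  selected? t (L _ _)    = no λ ()
  selected? t (Pd _ _ _) = no λ ()
  selected? t (El _)     = no λ ()
  selected? t U          = no λ ()

  col₁ : ℕ → Coloring (Vtx k r m) (suc k)
  col₁ t = paint (selected? t) top col₀

  chosen : ∀ {t} → t < k → Vtx k r m
  chosen p = I (fromℕ< p) (σ (fromℕ< p))

  selected-step : ∀ {t} (p : t < k) {w} → Selected (suc t) w → Selected t w ⊎ w ≡ chosen p
  selected-step {t} p {I i x} (lt , refl) with m<1+n⇒m<n∨m≡n lt
  ... | inj₁ earlier = inj₁ (earlier , refl)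
  ... | inj₂ now with toℕ-injective (trans now (sym (toℕ-fromℕ< p)))
  ... | refl = inj₂ refl

  chosen-selected : ∀ {t} (p : t < k) → Selected (suc t) (chosen p)
  chosen-selected {t} p = subst (_< suc t) (sym (toℕ-fromℕ< p)) ≤-refl , refl

  chosen-colour : ∀ {t} (p : t < k) → col₁ t (chosen p) ≡ inject₁ (fromℕ< p)
  chosen-colour {t} p = paint-out (selected? t) {w = chosen p} λ (lt , _) → <-irrefl (toℕ-fromℕ< p) lt

  -- The chosen vertex is alone in its component: its neighbours have colour k+1.
  chosen-isolated : ∀ {t} (p : t < k) {w} → Comp G (col₁ t) (chosen p) w → w ≡ chosen p
  chosen-isolated {t} p = comp-isolated λ adj eq →
    top≢ (fromℕ< p) (trans (sym (neighbour-top adj)) (trans eq (chosen-colour p)))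
    where
    neighbour-top : ∀ {x w} → G (I (fromℕ< p) x) w → col₁ t w ≡ top
    neighbour-top (inj₂ (LI _ _ _))   = refl
    neighbour-top (inj₂ (EI _ _ _ _)) = refl
    neighbour-top (inj₂ (UI _ _))     = refl

  phase₁-move : ∀ t → t < k → OneMove (col₁ t) (col₁ (suc t))
  phase₁-move t p = chosen p , top ,
    growth-move (selected? t) (selected? (suc t)) earlier⊆ comp⊆ outside
    where
    earlier⊆ : Selected t ⊆ Selected (suc t)
    earlier⊆ {I _ _} (lt , eq) = m<n⇒m<1+n lt , eq

    comp⊆ : Comp G (col₁ t) (chosen p) ⊆ Selected (suc t)
    comp⊆ comp = subst (Selected (suc t)) (sym (chosen-isolated p comp)) (chosen-selected p)

    outside : ∀ {w} → Selected (suc t) w → ¬ Comp G (col₁ t) (chosen p) w → col₁ t w ≡ top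
    outside q ¬comp with selected-step p q
    ... | inj₁ earlier = paint-in (selected? t) earlier
    ... | inj₂ refl    = ⊥-elim (¬comp here)

  -- Phase 2.  cur s: colour of u's component after s moves of phase 2.
  cur : ℕ → Fin (suc k)
  cur zero = top
  cur (suc s) with s <? k
  ... | yes p = inject₁ (fromℕ< p)
  ... | no _  = top

  cur-at : ∀ {s} (i : Fin k) → toℕ i ≡ s → cur (suc s) ≡ inject₁ i
  cur-at i refl with toℕ i <? k
  ... | yes p  = cong inject₁ (toℕ-injective (toℕ-fromℕ< p))
  ... | no ¬p  = ⊥-elim (¬p (toℕ<n i))

  cur-fresh : ∀ s (i : Fin k) → s ≤ toℕ i → cur s ≢ inject₁ i
  cur-fresh zero    i _ = top≢ i
  cur-fresh (suc s) i s<i with s <? k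
  ... | yes p = λ eq → <-irrefl (trans (sym (toℕ-fromℕ< p)) (cong toℕ (inject₁-injective eq))) s<i
  ... | no _  = top≢ i

  -- Flooded s: the component of u after s moves of phase 2.
  Flooded : ℕ → Vtx k r m → Set
  Flooded s (I i x)    = x ≡ σ i ⊎ toℕ i < s
  Flooded s (L _ _)    = ⊤
  Flooded s (Pd _ _ c) = toℕ c < s
  Flooded s (El _)     = ⊤
  Flooded s U          = ⊤

  flooded? : ∀ s → Decidable (Flooded s)
  flooded? s (I i x)    = (x ≟ σ i) ⊎-dec (toℕ i <? s)
  flooded? s (L _ _)    = yes tt
  flooded? s (Pd _ _ c) = toℕ c <? s
  flooded? s (El _)     = yes tt
  flooded? s U          = yes tt

  col₂ : ℕ → Coloring (Vtx k r m) (suc k)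
  col₂ s = paint (flooded? s) (cur s) col₀

  flooded-step : ∀ s → Flooded s ⊆ Flooded (suc s)
  flooded-step s {I _ _}    (inj₁ eq) = inj₁ eq
  flooded-step s {I _ _}    (inj₂ lt) = inj₂ (m<n⇒m<1+n lt)
  flooded-step s {L _ _}    _  = tt
  flooded-step s {Pd _ _ _} lt = m<n⇒m<1+n lt
  flooded-step s {El _}     _  = tt
  flooded-step s {U}        _  = tt

  flooded-all : ∀ w → Flooded k w
  flooded-all (I i _)    = inj₂ (toℕ<n i)
  flooded-all (L _ _)    = tt
  flooded-all (Pd _ _ c) = toℕ<n c
  flooded-all (El _)     = tt
  flooded-all U          = tt

  unflooded-colour : ∀ s {w} → ¬ Flooded s w → col₀ w ≢ cur s
  unflooded-colour s {I i _}    ¬f eq = cur-fresh s i (≮⇒≥ λ lt → ¬f (inj₂ lt)) (sym eq)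
  unflooded-colour s {L _ _}    ¬f    = ⊥-elim (¬f tt)
  unflooded-colour s {Pd _ _ c} ¬f eq = cur-fresh s c (≮⇒≥ ¬f) (sym eq)
  unflooded-colour s {El _}     ¬f    = ⊥-elim (¬f tt)
  unflooded-colour s {U}        ¬f    = ⊥-elim (¬f tt)

  newly-flooded-colour : ∀ s {w} → Flooded (suc s) w → ¬ Flooded s w → col₀ w ≡ cur (suc s)
  newly-flooded-colour s {I i _} (inj₁ eq) ¬f = ⊥-elim (¬f (inj₁ eq))
  newly-flooded-colour s {I i _} (inj₂ lt) ¬f with m<1+n⇒m<n∨m≡n lt
  ... | inj₁ earlier = ⊥-elim (¬f (inj₂ earlier))
  ... | inj₂ now     = sym (cur-at i now)
  newly-flooded-colour s {L _ _} _ ¬f = ⊥-elim (¬f tt)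
  newly-flooded-colour s {Pd _ _ c} lt ¬f with m<1+n⇒m<n∨m≡n lt
  ... | inj₁ earlier = ⊥-elim (¬f earlier)
  ... | inj₂ now     = sym (cur-at c now)
  newly-flooded-colour s {El _} _ ¬f = ⊥-elim (¬f tt)
  newly-flooded-colour s {U}    _ ¬f = ⊥-elim (¬f tt)

  comp⊆flooded : ∀ s → Comp G (col₂ s) U ⊆ Flooded s
  comp⊆flooded s {w} comp with flooded? s w
  ... | yes f = f
  ... | no ¬f = ⊥-elim (unflooded-colour s ¬f
                  (trans (sym (paint-out (flooded? s) ¬f)) (comp-colour comp)))

  extend : ∀ {s w w′} → Comp G (col₂ s) U w → G w w′ → Flooded s w′ → Comp G (col₂ s) U w′
  extend {s} comp adj f =
    step comp adj (trans (on-region f) (sym (on-region {U} tt)))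
    where
    on-region : ∀ {v} → Flooded s v → col₂ s v ≡ cur s
    on-region f = paint-in (flooded? s) {cur s} {col₀} f

  -- Every flooded vertex is joined to u through flooded vertices: the chosen
  -- sets directly, each L_i through the chosen set of 𝒮_i, the pendants through
  -- their L-vertex, and the element vertices through a chosen set covering them.
  reach-chosen : ∀ s i → Comp G (col₂ s) U (I i (σ i))
  reach-chosen s i = extend here (inj₁ (UI i (σ i))) (inj₁ refl)

  reach-L : ∀ s i j → Comp G (col₂ s) U (L i j)
  reach-L s i j = extend (reach-chosen s i) (inj₂ (LI i j (σ i))) tt

  flooded⊆comp : ∀ s → Flooded s ⊆ Comp G (col₂ s) U
  flooded⊆comp s {I i x}    f = extend here (inj₁ (UI i x)) f
  flooded⊆comp s {L i j}    f = reach-L s i j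
  flooded⊆comp s {Pd i j c} f = extend (reach-L s i j) (inj₁ (LP i j c)) f
  flooded⊆comp s {El e}     f with cover e
  ... | i , e∈σi = extend (reach-chosen s i) (inj₂ (EI e i (σ i) e∈σi)) f
  flooded⊆comp s {U}        f = here

  phase₂-move : ∀ s → OneMove (col₂ s) (col₂ (suc s))
  phase₂-move s = U , cur (suc s) ,
    growth-move (flooded? s) (flooded? (suc s)) (flooded-step s)
                (λ comp → flooded-step s (comp⊆flooded s comp)) outside
    where
    outside : ∀ {w} → Flooded (suc s) w → ¬ Comp G (col₂ s) U w → col₂ s w ≡ cur (suc s)
    outside f ¬comp = trans (paint-out (flooded? s) ¬f) (newly-flooded-colour s f ¬f)
      where ¬f = λ f′ → ¬comp (flooded⊆comp s f′)

  phase₁-start : ∀ w → col₁ 0 w ≡ col₀ w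
  phase₁-start w = paint-out (selected? 0) (none w)
    where
    none : ∀ w → ¬ Selected 0 w
    none (I _ _) (() , _)

  phase₁-end : ∀ w → col₁ k w ≡ col₂ 0 w
  phase₁-end = paint-extend (selected? k) (flooded? 0) selected⊆ added
    where
    selected⊆ : Selected k ⊆ Flooded 0
    selected⊆ {I _ _} (_ , eq) = inj₁ eq

    added : ∀ {w} → Flooded 0 w → ¬ Selected k w → col₀ w ≡ top
    added {I i _} (inj₁ eq) ¬sel = ⊥-elim (¬sel (toℕ<n i , eq))
    added {L _ _} _ _ = refl
    added {El _}  _ _ = refl
    added {U}     _ _ = refl

  floods : Floods G col₀ (2 * k)
  floods =
    floods-resp phase₁-start
      (moves-then-flood k col₁ phase₁-move
        (floods-resp (λ w → sym (phase₁-end w))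
          (moves-then-flood k col₂ (λ s _ → phase₂-move s)
            (done (paint-constant (flooded? k) flooded-all)))))

lemma4 : (k r : ℕ) (m : Fin k → ℕ) (𝒮 : (i : Fin k) → Fin (m i) → Subset r) →
         (Σ ((i : Fin k) → Fin (m i)) λ σ → ∀ (e : Fin r) → ∃[ i ] (e ∈ 𝒮 i (σ i))) →
         OPTFree≤ (Adj k r m 𝒮) (colG k r m) (2 * k)
lemma4 k r m 𝒮 (σ , cover) = 2 * k , ≤-refl , Construction.floods k r m 𝒮 σ cover
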